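{- Let $d\ge 1$, let $p_1,\dots,p_{d-1}$ be nonnegative integers and $p_d\ge 2$ an integer. Let $\alpha=p_1+\cdots+p_{d-1}$ and $k=\left\lfloor\frac{p_d-2}{\alpha+1}\right\rfloor$, and let $T_{p_1\dots p_d}=\operatorname{conv}\{e_1,\dots,e_{d+1},(p_1,\dots,p_d,1)\}\subset\mathbb R^{d+1}$. Let $h=(a_1,\dots,a_{d+1})\in\mathbb Z^{d+1}$ be a primitive vector with $\operatorname{w}_h(T_{p_1\dots p_d})\le k+2$. Then $a_d\in\{0,1,-1\}$.
   Context: $e_1,\dots,e_{d+1}$ is the standard basis of $\mathbb R^{d+1}$. An integer vector is primitive if the gcd of its entries is $1$. For a lattice polytope $P$ and an integer vector $h$, the lattice width of $P$ in direction $h$ is $\operatorname{w}_h(P)=\max_{x\in P}\langle h,x\rangle-\min_{x\in P}\langle h,x\rangle$, with $\langle\cdot,\cdot\rangle$ the standard inner product. -}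

module Defs where

open import Data.Nat as ℕ using (ℕ; zero; suc)
open import Data.Nat.GCD using (gcd)
open import Data.Nat.DivMod using (_/_)
open import Data.Fin using (Fin; zero; suc; fromℕ; inject₁; _≟_)
open import Data.Integer as ℤ using (ℤ; +_; _⊔_; _⊓_; ∣_∣)
open import Data.List using (List; []; _∷_; map; allFin)
open import Relation.Nullary using (yes; no)

Point : ℕ → Set
Point m = Fin m → ℤ

sumFin : (m : ℕ) → (Fin m → ℤ) → ℤ
sumFin zero    f = + 0
sumFin (suc m) f = f zero ℤ.+ sumFin m (λ i → f (suc i))

sumFinℕ : (m : ℕ) → (Fin m → ℕ) → ℕ
sumFinℕ zero    f = 0
sumFinℕ (suc m) f = f zero ℕ.+ sumFinℕ m (λ i → f (suc i))

⟨_,_⟩ : {m : ℕ} → Point m → Point m → ℤ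
⟨_,_⟩ {m} x y = sumFin m (λ i → x i ℤ.* y i)

-- standard basis vector e_{i+1} (0-based index i)
e : {m : ℕ} → Fin m → Point m
e i j with i ≟ j
... | yes _ = + 1
... | no  _ = + 0

gcdVec : (m : ℕ) → Point m → ℕ
gcdVec zero    h = 0
gcdVec (suc m) h = gcd ∣ h zero ∣ (gcdVec m (λ i → h (suc i)))

Primitive : {m : ℕ} → Point m → Set
Primitive {m} h = gcdVec m h ≡ 1
  where open import Relation.Binary.PropositionalEquality using (_≡_)

snoc : {m : ℕ} → Point m → ℤ → Point (suc m)
snoc {zero}  x c zero    = c
snoc {suc m} x c zero    = x zero
snoc {suc m} x c (suc i) = snoc (λ j → x (suc j)) c i

-- A lattice polytope given as conv of a nonempty finite list of lattice points
-- (first point, remaining points).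
record Polytope (m : ℕ) : Set where
  constructor conv
  field
    v₀  : Point m
    vs  : List (Point m)

maxL : ℤ → List ℤ → ℤ
maxL a []       = a
maxL a (b ∷ bs) = a ⊔ maxL b bs

minL : ℤ → List ℤ → ℤ
minL a []       = a
minL a (b ∷ bs) = a ⊓ minL b bs

-- lattice width w_h(P) = max_{x∈P}⟨h,x⟩ - min_{x∈P}⟨h,x⟩; a linear functional on
-- conv(V) attains its max/min at points of V, so it is computed over the vertex list.
width : {m : ℕ} → Point m → Polytope m → ℤ
width h (conv v₀ vs) =
  maxL ⟨ h , v₀ ⟩ (map (λ x → ⟨ h , x ⟩) vs) ℤ.- minL ⟨ h , v₀ ⟩ (map (λ x → ⟨ h , x ⟩) vs)

T : {d : ℕ} → (Fin d → ℕ) → Polytope (suc d)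
T {d} p = conv (snoc (λ i → + p i) (+ 1)) (map e (allFin (suc d)))

-- For d = suc n: p_d = p (fromℕ n), α = p_1+…+p_{d-1}, k = ⌊(p_d-2)/(α+1)⌋
pLast : {n : ℕ} → (Fin (suc n) → ℕ) → ℕ
pLast {n} p = p (fromℕ n)

α : {n : ℕ} → (Fin (suc n) → ℕ) → ℕ
α {n} p = sumFinℕ n (λ i → p (inject₁ i))

kk : {n : ℕ} → (Fin (suc n) → ℕ) → ℕ
kk p = (pLast p ℕ.∸ 2) / suc (α p)

{-# OPTIONS --safe #-}
module Submission where

open import Defs
open import Data.Nat using (ℕ; suc; _≤_)
open import Data.Fin using (Fin; fromℕ; inject₁)
open import Data.Integer using (ℤ; +_; -[1+_]) renaming (_≤_ to _≤ℤ_)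
open import Data.Sum using (_⊎_)
open import Relation.Binary.PropositionalEquality using (_≡_)

import Data.Nat as ℕ
import Data.Nat.Properties as ℕ
open import Data.Nat.DivMod using (_/_; m/n*n≤m)
import Data.Nat.Tactic.RingSolver as ℕ-Solver
open import Data.Fin using (zero; suc; _≟_)
open import Data.Fin.Properties using (suc-injective)
open import Data.Integer using (_+_; _*_; _-_; -_; _⊔_; _⊓_; _<_; 0ℤ; 1ℤ; +≤+; +<+; nonNegative)
open import Data.Integer.Properties
  using ( ≤-refl; ≤-trans; module ≤-Reasoning; +-mono-≤; +-monoʳ-≤; +-monoˡ-≤
        ; +-identityˡ; +-identityʳ; +-assoc; *-identityʳ; *-zeroʳ; pos-+; pos-*
        ; neg-distrib-+; neg-distribˡ-*; neg-distrib-⊓-⊔; neg-distrib-⊔-⊓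
        ; i≤i⊔j; i≤j⊔i; i⊓j≤i; i⊓j≤j; i≤j⇒0≤j-i; *-monoʳ-≤-nonNeg; *-cancelʳ-<-nonNeg )
open import Data.Integer.Tactic.RingSolver using (solve-∀)
open import Data.List using (List; []; _∷_; map)
open import Data.List.Properties using (map-cong; map-∘)
open import Data.List.Relation.Unary.Any using (here; there)
open import Data.List.Membership.Propositional using (_∈_)
open import Data.List.Membership.Propositional.Properties using (∈-map⁺; ∈-allFin)
open import Data.Sum using (inj₁; inj₂)
open import Data.Empty using (⊥-elim)
open import Function using (_∘_)
open import Relation.Nullary using (yes; no; ¬_)
open import Relation.Binary.PropositionalEquality using (refl; sym; trans; cong; cong₂; subst; module ≡-Reasoning)

-- Let L and U be the least and the largest value of h on the vertices of T, so that
-- U − L ≤ k + 2 and L ≤ a_i ≤ U for every i. Evaluating h at the apex (p_1,…,p_d,1) and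
-- bounding every a_i with i ≠ d below by L gives L(α + 1) + a_d p_d ≤ U; together with
-- a_d ≤ U ≤ L + k + 2 this yields a_d (α + p_d) ≤ (k + 2)(α + 1) ≤ p_d + 2α < 2(α + p_d),
-- hence a_d < 2. As −h has the same width, also −a_d < 2.

sumFin-nonNeg : ∀ m {f : Fin m → ℤ} → (∀ i → 0ℤ ≤ℤ f i) → 0ℤ ≤ℤ sumFin m f
sumFin-nonNeg ℕ.zero    f≥0 = ≤-refl
sumFin-nonNeg (suc m) f≥0 = +-mono-≤ (f≥0 zero) (sumFin-nonNeg m (f≥0 ∘ suc))

term≤sumFin : ∀ m {f : Fin m → ℤ} → (∀ i → 0ℤ ≤ℤ f i) → ∀ j → f j ≤ℤ sumFin m f
term≤sumFin (suc m) {f} f≥0 zero = begin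
  f zero                 ≡⟨ sym (+-identityʳ (f zero)) ⟩
  f zero + 0ℤ            ≤⟨ +-monoʳ-≤ (f zero) (sumFin-nonNeg m (f≥0 ∘ suc)) ⟩
  f zero + sumFin m (f ∘ suc) ∎
  where open ≤-Reasoning
term≤sumFin (suc m) {f} f≥0 (suc j) = begin
  f (suc j)              ≤⟨ term≤sumFin m (f≥0 ∘ suc) j ⟩
  sumFin m (f ∘ suc)     ≡⟨ sym (+-identityˡ _) ⟩
  0ℤ + sumFin m (f ∘ suc) ≤⟨ +-monoˡ-≤ _ (f≥0 zero) ⟩
  f zero + sumFin m (f ∘ suc) ∎
  where open ≤-Reasoning

sumFin-zero : ∀ m {f : Fin m → ℤ} → (∀ i → f i ≡ 0ℤ) → sumFin m f ≡ 0ℤ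
sumFin-zero ℕ.zero    f≡0 = refl
sumFin-zero (suc m) f≡0 rewrite f≡0 zero = trans (+-identityˡ _) (sumFin-zero m (f≡0 ∘ suc))

sumFin-single : ∀ m {f : Fin m → ℤ} (i : Fin m) → (∀ j → ¬ i ≡ j → f j ≡ 0ℤ) → sumFin m f ≡ f i
sumFin-single (suc m) {f} zero f≡0
  rewrite sumFin-zero m (λ j → f≡0 (suc j) λ ()) = +-identityʳ (f zero)
sumFin-single (suc m) {f} (suc i) f≡0 rewrite f≡0 zero (λ ()) =
  trans (+-identityˡ _) (sumFin-single m i (λ j i≢j → f≡0 (suc j) (i≢j ∘ suc-injective)))

sumFin-snoc : ∀ m (x : Point m) c → sumFin (suc m) (snoc x c) ≡ sumFin m x + c
sumFin-snoc ℕ.zero    x c = trans (+-identityʳ c) (sym (+-identityˡ c))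
sumFin-snoc (suc m) x c =
  trans (cong (_+_ (x zero)) (sumFin-snoc m (x ∘ suc) c)) (sym (+-assoc (x zero) _ c))

sumFin-inject₁ : ∀ m (f : Fin (suc m) → ℤ) → sumFin (suc m) f ≡ sumFin m (f ∘ inject₁) + f (fromℕ m)
sumFin-inject₁ ℕ.zero    f = trans (+-identityʳ (f zero)) (sym (+-identityˡ (f zero)))
sumFin-inject₁ (suc m) f =
  trans (cong (_+_ (f zero)) (sumFin-inject₁ m (f ∘ suc))) (sym (+-assoc (f zero) _ _))

sumFin-pos : ∀ m (q : Fin m → ℕ) → sumFin m (+_ ∘ q) ≡ + sumFinℕ m q
sumFin-pos ℕ.zero    q = refl
sumFin-pos (suc m) q = trans (cong (_+_ (+ q zero)) (sumFin-pos m (q ∘ suc))) (sym (pos-+ (q zero) _))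

sumFin-cong : ∀ m {f g : Fin m → ℤ} → (∀ i → f i ≡ g i) → sumFin m f ≡ sumFin m g
sumFin-cong ℕ.zero    f≡g = refl
sumFin-cong (suc m) f≡g = cong₂ _+_ (f≡g zero) (sumFin-cong m (f≡g ∘ suc))

sumFin-neg : ∀ m (f : Fin m → ℤ) → sumFin m (-_ ∘ f) ≡ - sumFin m f
sumFin-neg ℕ.zero    f = refl
sumFin-neg (suc m) f =
  trans (cong (_+_ (- f zero)) (sumFin-neg m (f ∘ suc))) (sym (neg-distrib-+ (f zero) _))

⟨⟩-neg : ∀ {m} (h x : Point m) → ⟨ -_ ∘ h , x ⟩ ≡ - ⟨ h , x ⟩
⟨⟩-neg {m} h x = begin
  sumFin m (λ i → - h i * x i)    ≡⟨ sumFin-cong m (λ i → sym (neg-distribˡ-* (h i) (x i))) ⟩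
  sumFin m (λ i → - (h i * x i))  ≡⟨ sumFin-neg m (λ i → h i * x i) ⟩
  - ⟨ h , x ⟩                     ∎
  where open ≡-Reasoning

⟨⟩-e : ∀ {m} (h : Point m) (i : Fin m) → ⟨ h , e i ⟩ ≡ h i
⟨⟩-e {m} h i = trans (sumFin-single m i off-i) at-i
  where
  off-i : ∀ j → ¬ i ≡ j → h j * e i j ≡ 0ℤ
  off-i j i≢j with i ≟ j
  ... | yes i≡j = ⊥-elim (i≢j i≡j)
  ... | no  _   = *-zeroʳ (h j)
  at-i : h i * e i i ≡ h i
  at-i with i ≟ i
  ... | yes _   = *-identityʳ (h i)
  ... | no  i≢i = ⊥-elim (i≢i refl)

⟨⟩-split : ∀ m (h v : Point m) L → ⟨ h , v ⟩ ≡ L * sumFin m v + sumFin m (λ i → (h i - L) * v i)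
⟨⟩-split ℕ.zero    h v L = sym (trans (+-identityʳ (L * 0ℤ)) (*-zeroʳ L))
⟨⟩-split (suc m) h v L = begin
  h zero * v zero + ⟨ h ∘ suc , v ∘ suc ⟩
    ≡⟨ cong (_+_ (h zero * v zero)) (⟨⟩-split m (h ∘ suc) (v ∘ suc) L) ⟩
  h zero * v zero + (L * sumFin m (v ∘ suc) + sumFin m (λ i → (h (suc i) - L) * v (suc i)))
    ≡⟨ regroup (h zero) (v zero) L _ _ ⟩
  L * (v zero + sumFin m (v ∘ suc)) + ((h zero - L) * v zero + sumFin m (λ i → (h (suc i) - L) * v (suc i)))
    ∎
  where
  open ≡-Reasoning
  regroup : ∀ h₀ v₀ L S S′ → h₀ * v₀ + (L * S + S′) ≡ L * (v₀ + S) + ((h₀ - L) * v₀ + S′)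
  regroup = solve-∀

⟨⟩-lowerBound : ∀ m (h v : Point m) L → (∀ i → L ≤ℤ h i) → (∀ i → 0ℤ ≤ℤ v i) →
                ∀ j → L * sumFin m v + (h j - L) * v j ≤ℤ ⟨ h , v ⟩
⟨⟩-lowerBound m h v L L≤h v≥0 j = begin
  L * sumFin m v + (h j - L) * v j
    ≤⟨ +-monoʳ-≤ (L * sumFin m v) (term≤sumFin m excess≥0 j) ⟩
  L * sumFin m v + sumFin m (λ i → (h i - L) * v i)
    ≡⟨ sym (⟨⟩-split m h v L) ⟩
  ⟨ h , v ⟩
    ∎
  where
  open ≤-Reasoning
  excess≥0 : ∀ i → 0ℤ ≤ℤ (h i - L) * v i
  excess≥0 i = *-monoʳ-≤-nonNeg (v i) {{nonNegative (v≥0 i)}} (i≤j⇒0≤j-i (L≤h i))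

∈⇒≤maxL : ∀ {a b} bs → b ∈ a ∷ bs → b ≤ℤ maxL a bs
∈⇒≤maxL []       (here refl)  = ≤-refl
∈⇒≤maxL (c ∷ cs) (here refl)  = i≤i⊔j _ _
∈⇒≤maxL (c ∷ cs) (there b∈cs) = ≤-trans (∈⇒≤maxL cs b∈cs) (i≤j⊔i _ _)

∈⇒minL≤ : ∀ {a b} bs → b ∈ a ∷ bs → minL a bs ≤ℤ b
∈⇒minL≤ []       (here refl)  = ≤-refl
∈⇒minL≤ (c ∷ cs) (here refl)  = i⊓j≤i _ _
∈⇒minL≤ (c ∷ cs) (there b∈cs) = ≤-trans (i⊓j≤j _ _) (∈⇒minL≤ cs b∈cs)

maxL-neg : ∀ a bs → maxL (- a) (map -_ bs) ≡ - minL a bs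
maxL-neg a []       = refl
maxL-neg a (b ∷ bs) = trans (cong (_⊔_ (- a)) (maxL-neg b bs)) (sym (neg-distrib-⊓-⊔ a _))

minL-neg : ∀ a bs → minL (- a) (map -_ bs) ≡ - maxL a bs
minL-neg a []       = refl
minL-neg a (b ∷ bs) = trans (cong (_⊓_ (- a)) (minL-neg b bs)) (sym (neg-distrib-⊔-⊓ a _))

vertices : ∀ {m} → Polytope m → List (Point m)
vertices (conv v₀ vs) = v₀ ∷ vs

maxValue minValue : ∀ {m} → Point m → Polytope m → ℤ
maxValue h (conv v₀ vs) = maxL ⟨ h , v₀ ⟩ (map ⟨ h ,_⟩ vs)
minValue h (conv v₀ vs) = minL ⟨ h , v₀ ⟩ (map ⟨ h ,_⟩ vs)

≤maxValue : ∀ {m} (h : Point m) (P : Polytope m) {x} → x ∈ vertices P → ⟨ h , x ⟩ ≤ℤ maxValue h P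
≤maxValue h (conv v₀ vs) x∈P = ∈⇒≤maxL (map ⟨ h ,_⟩ vs) (∈-map⁺ ⟨ h ,_⟩ x∈P)

minValue≤ : ∀ {m} (h : Point m) (P : Polytope m) {x} → x ∈ vertices P → minValue h P ≤ℤ ⟨ h , x ⟩
minValue≤ h (conv v₀ vs) x∈P = ∈⇒minL≤ (map ⟨ h ,_⟩ vs) (∈-map⁺ ⟨ h ,_⟩ x∈P)

width-neg : ∀ {m} (h : Point m) (P : Polytope m) → width (-_ ∘ h) P ≡ width h P
width-neg h (conv v₀ vs) = begin
  width (-_ ∘ h) (conv v₀ vs)
    ≡⟨ cong₂ (λ a bs → maxL a bs - minL a bs) (⟨⟩-neg h v₀) (trans (map-cong (⟨⟩-neg h) vs) (map-∘ vs)) ⟩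
  maxL (- ⟨ h , v₀ ⟩) values⁻ - minL (- ⟨ h , v₀ ⟩) values⁻
    ≡⟨ cong₂ _-_ (maxL-neg ⟨ h , v₀ ⟩ values) (minL-neg ⟨ h , v₀ ⟩ values) ⟩
  - minL ⟨ h , v₀ ⟩ values - - maxL ⟨ h , v₀ ⟩ values
    ≡⟨ swap-neg (minL ⟨ h , v₀ ⟩ values) (maxL ⟨ h , v₀ ⟩ values) ⟩
  maxL ⟨ h , v₀ ⟩ values - minL ⟨ h , v₀ ⟩ values
    ∎
  where
  open ≡-Reasoning
  values values⁻ : List ℤ
  values  = map ⟨ h ,_⟩ vs
  values⁻ = map -_ values
  swap-neg : ∀ x y → - x - - y ≡ y - x
  swap-neg = solve-∀

snoc-all : ∀ {m} (P : ℤ → Set) {x : Point m} {c} → (∀ i → P (x i)) → P c → ∀ i → P (snoc x c i)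
snoc-all {ℕ.zero} P Px Pc zero    = Pc
snoc-all {suc m}  P Px Pc zero    = Px zero
snoc-all {suc m}  P Px Pc (suc i) = snoc-all P (Px ∘ suc) Pc i

snoc-inject₁ : ∀ {m} (x : Point m) c i → snoc x c (inject₁ i) ≡ x i
snoc-inject₁ {suc m} x c zero    = refl
snoc-inject₁ {suc m} x c (suc i) = snoc-inject₁ (x ∘ suc) c i

apex : ∀ {n} → (Fin (suc n) → ℕ) → Point (suc (suc n))
apex p = snoc (+_ ∘ p) 1ℤ

apex-nonNeg : ∀ {n} (p : Fin (suc n) → ℕ) i → 0ℤ ≤ℤ apex p i
apex-nonNeg p = snoc-all (0ℤ ≤ℤ_) (λ _ → +≤+ ℕ.z≤n) (+≤+ ℕ.z≤n)

sumFin-apex : ∀ n (p : Fin (suc n) → ℕ) → sumFin (suc (suc n)) (apex p) ≡ + α p + + pLast p + 1ℤ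
sumFin-apex n p = begin
  sumFin (suc (suc n)) (apex p)
    ≡⟨ sumFin-snoc (suc n) (+_ ∘ p) 1ℤ ⟩
  sumFin (suc n) (+_ ∘ p) + 1ℤ
    ≡⟨ cong (_+ 1ℤ) (sumFin-inject₁ n (+_ ∘ p)) ⟩
  sumFin n (+_ ∘ p ∘ inject₁) + + pLast p + 1ℤ
    ≡⟨ cong (λ s → s + + pLast p + 1ℤ) (sumFin-pos n (p ∘ inject₁)) ⟩
  + α p + + pLast p + 1ℤ
    ∎
  where open ≡-Reasoning

e∈T : ∀ {n} (p : Fin (suc n) → ℕ) i → e i ∈ vertices (T p)
e∈T p i = there (∈-map⁺ e (∈-allFin i))

slope-bound : ∀ {A P L U a w} → 0ℤ ≤ℤ A →
              L * (A + P + 1ℤ) + (a - L) * P ≤ℤ U → a ≤ℤ U → U - L ≤ℤ w →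
              a * (A + P) ≤ℤ w * (1ℤ + A)
slope-bound {A} {P} {L} {U} {a} {w} A≥0 apex≤U a≤U U-L≤w = begin
  a * (A + P)                                          ≡⟨ regroup A P L a ⟩
  (L * (A + P + 1ℤ) + (a - L) * P - L) + (a - L) * A
    ≤⟨ +-mono-≤ (+-monoˡ-≤ (- L) apex≤U) (*-monoʳ-≤-nonNeg A {{nonNegative A≥0}} a-L≤w) ⟩
  (U - L) + w * A                                      ≤⟨ +-monoˡ-≤ (w * A) U-L≤w ⟩
  w + w * A                                            ≡⟨ sym (distrib w A) ⟩
  w * (1ℤ + A)                                         ∎
  where
  open ≤-Reasoning
  a-L≤w : a - L ≤ℤ w
  a-L≤w = ≤-trans (+-monoˡ-≤ (- L) a≤U) U-L≤w
  regroup : ∀ A P L a → a * (A + P) ≡ (L * (A + P + 1ℤ) + (a - L) * P - L) + (a - L) * A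
  regroup = solve-∀
  distrib : ∀ w A → w * (1ℤ + A) ≡ w + w * A
  distrib = solve-∀

[m/n+k]*n≤m+k*n : ∀ m n k .{{_ : ℕ.NonZero n}} → (m / n ℕ.+ k) ℕ.* n ≤ m ℕ.+ k ℕ.* n
[m/n+k]*n≤m+k*n m n k = begin
  (m / n ℕ.+ k) ℕ.* n        ≡⟨ ℕ.*-distribʳ-+ n (m / n) k ⟩
  m / n ℕ.* n ℕ.+ k ℕ.* n    ≤⟨ ℕ.+-monoˡ-≤ (k ℕ.* n) (m/n*n≤m m n) ⟩
  m ℕ.+ k ℕ.* n              ∎
  where open ℕ.≤-Reasoning

width-budget : ∀ P a → 2 ≤ P → ((P ℕ.∸ 2) / suc a ℕ.+ 2) ℕ.* suc a ℕ.< 2 ℕ.* (a ℕ.+ P)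
width-budget (suc ℕ.zero) a (ℕ.s≤s ())
width-budget (suc (suc r)) a _ = begin-strict
  (r / suc a ℕ.+ 2) ℕ.* suc a   ≤⟨ [m/n+k]*n≤m+k*n r (suc a) 2 ⟩
  r ℕ.+ 2 ℕ.* suc a             <⟨ ℕ.m<m+n (r ℕ.+ 2 ℕ.* suc a) (ℕ.s≤s (ℕ.z≤n {suc r})) ⟩
  r ℕ.+ 2 ℕ.* suc a ℕ.+ suc (suc r) ≡⟨ regroup r a ⟩
  2 ℕ.* (a ℕ.+ suc (suc r))     ∎
  where
  open ℕ.≤-Reasoning
  regroup : ∀ r a → r ℕ.+ 2 ℕ.* suc a ℕ.+ suc (suc r) ≡ 2 ℕ.* (a ℕ.+ suc (suc r))
  regroup = ℕ-Solver.solve-∀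

coefficient<2 : ∀ n (p : Fin (suc n) → ℕ) → 2 ≤ pLast p → (h : Point (suc (suc n))) →
                width h (T p) ≤ℤ + (kk p ℕ.+ 2) → h (inject₁ (fromℕ n)) < + 2
coefficient<2 n p 2≤P h w≤ = *-cancelʳ-<-nonNeg (A + P) (begin-strict
  a * (A + P)                           ≤⟨ slope-bound (+≤+ ℕ.z≤n) apex≤U a≤U w≤ ⟩
  + (kk p ℕ.+ 2) * + suc (α p)          ≡⟨ sym (pos-* (kk p ℕ.+ 2) (suc (α p))) ⟩
  + ((kk p ℕ.+ 2) ℕ.* suc (α p))        <⟨ +<+ (width-budget (pLast p) (α p) 2≤P) ⟩
  + (2 ℕ.* (α p ℕ.+ pLast p))           ≡⟨ pos-* 2 (α p ℕ.+ pLast p) ⟩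
  + 2 * (A + P)                         ∎)
  where
  open ≤-Reasoning
  A P L U a : ℤ
  A = + α p
  P = + pLast p
  L = minValue h (T p)
  U = maxValue h (T p)
  a = h (inject₁ (fromℕ n))
  L≤h : ∀ i → L ≤ℤ h i
  L≤h i = subst (L ≤ℤ_) (⟨⟩-e h i) (minValue≤ h (T p) (e∈T p i))
  a≤U : a ≤ℤ U
  a≤U = subst (_≤ℤ U) (⟨⟩-e h _) (≤maxValue h (T p) (e∈T p _))
  apex≤U : L * (A + P + 1ℤ) + (a - L) * P ≤ℤ U
  apex≤U = begin
    L * (A + P + 1ℤ) + (a - L) * P
      ≡⟨ sym (cong₂ (λ s t → L * s + (a - L) * t) (sumFin-apex n p) (snoc-inject₁ (+_ ∘ p) 1ℤ (fromℕ n))) ⟩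
    L * sumFin _ (apex p) + (a - L) * apex p (inject₁ (fromℕ n))
      ≤⟨ ⟨⟩-lowerBound _ h (apex p) L L≤h (apex-nonNeg p) _ ⟩
    ⟨ h , apex p ⟩
      ≤⟨ ≤maxValue h (T p) (here refl) ⟩
    U ∎

∣i∣<2-cases : ∀ a → a < + 2 → - a < + 2 → (a ≡ + 0) ⊎ (a ≡ + 1) ⊎ (a ≡ -[1+ 0 ])
∣i∣<2-cases (+ 0)           _ _ = inj₁ refl
∣i∣<2-cases (+ 1)           _ _ = inj₂ (inj₁ refl)
∣i∣<2-cases (+ suc (suc r)) (+<+ (ℕ.s≤s (ℕ.s≤s ()))) _
∣i∣<2-cases -[1+ 0 ]        _ _ = inj₂ (inj₂ refl)
∣i∣<2-cases -[1+ suc r ]    _ (+<+ (ℕ.s≤s (ℕ.s≤s ())))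

lemma3p2 : (n : ℕ) (p : Fin (suc n) → ℕ) → 2 ≤ pLast p →
    (h : Point (suc (suc n))) → Primitive h →
    width h (T p) ≤ℤ + (kk p Data.Nat.+ 2) →
    (h (inject₁ (fromℕ n)) ≡ + 0) ⊎ (h (inject₁ (fromℕ n)) ≡ + 1) ⊎ (h (inject₁ (fromℕ n)) ≡ -[1+ 0 ])
lemma3p2 n p 2≤P h _ w≤ =
  ∣i∣<2-cases _ (coefficient<2 n p 2≤P h w≤)
                (coefficient<2 n p 2≤P (-_ ∘ h) (subst (_≤ℤ _) (sym (width-neg h (T p))) w≤))
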